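{- Let $\lambda\vdash n$ have all parts of size at least $m+1$, and let $K$ be a constraint of size $m$ on $[n]$. If $K$ is acyclic, then \[\Pr_{\lambda}[\omega \text{ satisfies } K] = \frac{1}{(n-1)(n-2)\cdots(n-m)}.\] If $K$ is not acyclic, then $\Pr_{\lambda}[\omega \text{ satisfies } K] = 0$.
   Context: $\Pr_\lambda$ is the uniform probability measure on the conjugacy class $C_\lambda\subseteq S_n$ of permutations of cycle type $\lambda$. A constraint is a set $K=\{(i_1,j_1),\dots,(i_m,j_m)\}$ of distinct pairs with $i_t,j_t\in[n]$; its size is $m$. $\omega$ satisfies $K$ if $\omega(i_t)=j_t$ for all $t$. $K$ is well-defined if the $i_t$ are pairwise distinct and the $j_t$ are pairwise distinct. $G(K)$ is the directed graph on vertex set $[n]$ with an edge $i_t\to j_t$ for each pair of $K$. $K$ is acyclic if $K$ is well-defined and $G(K)$ has no (directed) cycle. -}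

module Defs where

open import Data.Nat as ℕ using (ℕ; zero; suc; _∸_; _*_; _≤_)
open import Data.Fin as Fin using (Fin)
open import Data.Fin.Properties using (_≟_; _≤?_)
open import Data.Vec using (Vec; lookup)
open import Data.List using (List; []; _∷_; map; filter; upTo; allFin; length)
open import Data.Nat.ListAction using (sum)
open import Data.List.Relation.Unary.All using (All; all?)
open import Data.List.Relation.Unary.Unique.Propositional using (Unique)
open import Data.List.Relation.Binary.Permutation.Propositional using (_↭_)
open import Data.List.Membership.Propositional using (_∈_)
open import Data.Product using (Σ; ∃; _×_; _,_; proj₁; proj₂)
open import Data.Bool using (if_then_else_)
open import Relation.Nullary using (¬_; does)
open import Relation.Binary.PropositionalEquality using (_≡_)
open import Function.Bundles using (_⇔_)

Map : ℕ → Set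
Map n = Vec (Fin n) n

-- ω is a permutation of [n] (injective, hence bijective on a finite set).
IsPerm : ∀ {n} → Map n → Set
IsPerm {n} ω = (i j : Fin n) → lookup ω i ≡ lookup ω j → i ≡ j

iter : ∀ {n} → Map n → ℕ → Fin n → Fin n
iter ω zero    i = i
iter ω (suc k) i = lookup ω (iter ω k i)

cycLenFrom : ∀ {n} → Map n → Fin n → ℕ → ℕ → ℕ
cycLenFrom ω i k zero     = k
cycLenFrom ω i k (suc f) =
  if does (iter ω k i ≟ i) then k else cycLenFrom ω i (suc k) f

-- length of the cycle of ω containing i (least k ≥ 1 with ω^k(i) = i;
-- for a permutation of [n] it is found among 1..n).
cycLen : ∀ {n} → Map n → Fin n → ℕ
cycLen {n} ω i = cycLenFrom ω i 1 n

-- i is the smallest element of its cycle (the orbit is {ω^k i | k < n})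
leader? : ∀ {n} (ω : Map n) (i : Fin n) → _
leader? {n} ω i = all? (λ k → i Fin.≤? iter ω k i) (upTo n)
  where open import Data.Fin using (_≤?_)

-- cycle type of ω: the multiset (list) of lengths of its cycles,
-- one entry per cycle (recorded at the cycle's smallest element).
cycleType : ∀ {n} → Map n → List ℕ
cycleType {n} ω = map (cycLen ω) (filter (leader? ω) (allFin n))

-- λ ⊢ n : a list of positive parts summing to n (order irrelevant, since
-- cycle types are compared up to permutation of the list).
IsPartition : ℕ → List ℕ → Set
IsPartition n λ' = All (λ p → 1 ≤ p) λ' × sum λ' ≡ n

InClass : ∀ {n} → List ℕ → Map n → Set
InClass λ' ω = IsPerm ω × (cycleType ω ↭ λ')

-- Constraints: lists of pairs (i , j), meaning ω(i) = j, pairwise distinct.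
Constraint : ℕ → Set
Constraint n = List (Fin n × Fin n)

Satisfies : ∀ {n} → Map n → Constraint n → Set
Satisfies ω K = All (λ e → lookup ω (proj₁ e) ≡ proj₂ e) K

WellDefined : ∀ {n} → Constraint n → Set
WellDefined K = Unique (map proj₁ K) × Unique (map proj₂ K)

data Walk {n} (K : Constraint n) : Fin n → Fin n → ℕ → Set where
  nil  : ∀ {a} → Walk K a a zero
  cons : ∀ {a b c k} → (a , b) ∈ K → Walk K b c k → Walk K a c (suc k)

HasCycle : ∀ {n} → Constraint n → Set
HasCycle {n} K = Σ (Fin n) λ a → Σ ℕ λ k → Walk K a a (suc k)

Acyclic : ∀ {n} → Constraint n → Set
Acyclic K = WellDefined K × ¬ HasCycle K

fallingFrom : ℕ → ℕ → ℕ
fallingFrom n zero    = 1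
fallingFrom n (suc m) = fallingFrom n m * (n ∸ suc m)

-- L is a duplicate-free enumeration of all maps satisfying P;
-- length L is then the cardinality of {ω | P ω}.
Enumerates : ∀ {n} → (Map n → Set) → List (Map n) → Set
Enumerates {n} P L = Unique L × ((ω : Map n) → (ω ∈ L) ⇔ P ω)

-- Write N(J) for the number of ω ∈ C_λ satisfying a constraint J. Every cycle of such an ω is longer than m,
-- so a constraint of size ≤ m satisfied by ω is well defined and acyclic: a closed walk in G(J) of length ≤ m
-- would be a short cycle of ω, and a longer one would visit m + 1 distinct points ω^t(v), all sources of J.
-- Hence N(K) = 0 unless K is acyclic.
--
-- For acyclic J we prove N(J)·(n-1)⋯(n-|J|) = |C_λ| by induction on |J| plus the number of points J touches.
-- Split off an edge (a, b) of J ending a path, leaving J′, and let s be the start of the path through a.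
-- Splitting by ω(a) gives N(J′) = Σₓ N(J′ + (a, x)). The summand vanishes for the |J′| + 1 values
-- x ∈ {s} ∪ targets(J′); when x starts another path, J′ + (a, x) no longer touches b, so by induction the
-- summand is |C_λ| / (n-1)⋯(n-|J|); and when x is untouched, conjugating by the transposition (x b) shows
-- that it equals N(J). As b itself is untouched and N(J′)·(n-1)⋯(n-|J′|) = |C_λ|, the sum forces
-- N(J) = |C_λ| / (n-1)⋯(n-|J|) as well.

module Submission where

open import Defs
open import Data.Bool using (if_then_else_; not)
open import Data.Empty using (⊥; ⊥-elim)
open import Data.Fin as Fin using (Fin; toℕ)
import Data.Fin.Properties as Fin
open import Data.Fin.Properties using (_≟_)
open import Data.Fin.Permutation using (Permutation′; _⟨$⟩ʳ_; _⟨$⟩ˡ_; inverseˡ; inverseʳ; flip; transpose)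
open import Data.List using (List; []; _∷_; _++_; length; map; filter; upTo; allFin)
open import Data.List.Properties
  using (filter-all; filter-none; filter-≐; map-cong; map-cong-local; map-id-local; map-∘; length-map; length-tabulate)
open import Data.List.Relation.Unary.All as All using (All; []; _∷_)
import Data.List.Relation.Unary.All.Properties as All
open import Data.List.Relation.Unary.Any as Any using (here; there)
open import Data.List.Relation.Unary.Unique.Propositional using (Unique; []; _∷_)
open import Data.List.Relation.Unary.Unique.Propositional.Properties
  using (filter⁺; allFin⁺; Unique[x∷xs]⇒x∉xs) renaming (map⁺ to Unique-map⁺)
open import Data.List.Membership.Propositional using (_∈_; _∉_; lose)
open import Data.List.Membership.Propositional.Properties
  using (∈-map⁺; ∈-map⁻; ∈-filter⁺; ∈-filter⁻; ∈-∃++; ∈-allFin; ∈-upTo⁺; ∈-++⁺ˡ; ∈-++⁺ʳ; ∈-++⁻)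
open import Data.List.Membership.Propositional.Properties.WithK using (unique∧set⇒bag)
import Data.List.Membership.DecPropositional as DecMembership
import Data.List.Membership.Setoid.Properties as SetoidMembership
open import Data.List.Relation.Binary.BagAndSetEquality using (∼bag⇒↭)
open import Data.List.Relation.Binary.Permutation.Propositional using (_↭_; ↭-sym; ↭-trans; ↭⇒↭ₛ)
open import Data.List.Relation.Binary.Permutation.Propositional.Properties
  using (↭-length; shift; map⁺; ++⁺; ∈-resp-↭; All-resp-↭)
import Data.List.Relation.Binary.Permutation.Setoid.Properties as PermutationSetoid
import Data.List.Relation.Binary.Subset.Propositional.Properties as Subset
open import Data.Nat using (ℕ; zero; suc; _+_; _*_; _∸_; _≤_; _<_; _≤?_; z≤n; s≤s; NonZero; >-nonZero)
open import Data.Nat.Properties hiding (_≟_)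
open import Algebra.Properties.CommutativeSemigroup +-commutativeSemigroup using (interchange)
open import Data.Nat.DivMod using (_%_; _/_; m≡m%n+[m/n]*n; m%n<n)
open import Data.Nat.Induction using (<-wellFounded)
open import Data.Nat.ListAction using (sum)
open import Data.Product using (∃; ∃₂; _×_; _,_; proj₁; proj₂)
import Data.Product as Product
open import Data.Sum using (_⊎_; inj₁; inj₂)
open import Data.Vec using (lookup; tabulate)
open import Data.Vec.Properties using (lookup∘tabulate; tabulate∘lookup; tabulate-cong)
open import Function using (_∘_; _⇔_; Equivalence; mk⇔)
open import Induction.WellFounded using (Acc; acc)
open import Level using (0ℓ)
open import Relation.Binary.Definitions using (tri<; tri≈; tri>)
open import Relation.Binary.PropositionalEquality
open import Relation.Nullary using (¬_; yes; no; does)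
open import Relation.Nullary.Decidable using (_×-dec_; dec-true; dec-false)
open import Relation.Unary using (Pred; Decidable)
open import Relation.Unary.Properties using (∁?)

-- Duplicate-free lists and counting

module _ {A : Set} where

  unique∧set⇒↭ : {xs ys : List A} → Unique xs → Unique ys →
    (∀ {x} → x ∈ xs → x ∈ ys) → (∀ {x} → x ∈ ys → x ∈ xs) → xs ↭ ys
  unique∧set⇒↭ u v xs⊆ys ys⊆xs = ∼bag⇒↭ (unique∧set⇒bag u v (mk⇔ xs⊆ys ys⊆xs))

  unique∧set⇒length≡ : {xs ys : List A} → Unique xs → Unique ys →
    (∀ {x} → x ∈ xs → x ∈ ys) → (∀ {x} → x ∈ ys → x ∈ xs) → length xs ≡ length ys
  unique∧set⇒length≡ u v xs⊆ys ys⊆xs = ↭-length (unique∧set⇒↭ u v xs⊆ys ys⊆xs)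

  Unique-resp-↭ : {xs ys : List A} → xs ↭ ys → Unique xs → Unique ys
  Unique-resp-↭ p = PermutationSetoid.Unique-resp-↭ (setoid A) (↭⇒↭ₛ p)

  ∈⇒↭∷ : {x : A} {xs : List A} → x ∈ xs → ∃ λ ys → xs ↭ x ∷ ys
  ∈⇒↭∷ x∈xs with ys , zs , refl ← ∈-∃++ x∈xs = ys ++ zs , shift _ ys zs

  ∉⇒Unique∷ : {x : A} {xs : List A} → x ∉ xs → Unique xs → Unique (x ∷ xs)
  ∉⇒Unique∷ {xs = xs} x∉xs u = All.¬Any⇒All¬ xs x∉xs ∷ u

module _ {A B : Set} {f : A → B} where

  map-unique-on : {xs : List A} → Unique xs →
    (∀ {x y} → x ∈ xs → y ∈ xs → f x ≡ f y → x ≡ y) → Unique (map f xs)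
  map-unique-on {[]} [] inj = []
  map-unique-on {x ∷ xs} (x∉xs ∷ u) inj =
    All.map⁺ (All.tabulate λ y∈xs fx≡fy → All.lookup x∉xs y∈xs (inj (here refl) (there y∈xs) fx≡fy))
    ∷ map-unique-on u (λ x∈ y∈ → inj (there x∈) (there y∈))

  unique-map⇒injective-on : {xs : List A} → Unique (map f xs) →
    ∀ {x y} → x ∈ xs → y ∈ xs → f x ≡ f y → x ≡ y
  unique-map⇒injective-on (_ ∷ _) (here refl) (here refl) _ = refl
  unique-map⇒injective-on (fx∉ ∷ _) (here refl) (there y∈) eq = ⊥-elim (All.lookup fx∉ (∈-map⁺ f y∈) eq)
  unique-map⇒injective-on (fy∉ ∷ _) (there x∈) (here refl) eq = ⊥-elim (All.lookup fy∉ (∈-map⁺ f x∈) (sym eq))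
  unique-map⇒injective-on (_ ∷ u) (there x∈) (there y∈) eq = unique-map⇒injective-on u x∈ y∈ eq

module _ {A : Set} {P Q : Pred A 0ℓ} (P? : Decidable P) (Q? : Decidable Q) where

  length-filter-mono : (∀ {x} → P x → Q x) → (xs : List A) →
    length (filter P? xs) ≤ length (filter Q? xs)
  length-filter-mono P⊆Q [] = z≤n
  length-filter-mono P⊆Q (x ∷ xs) with P? x | Q? x
  ... | yes _  | yes _  = s≤s (length-filter-mono P⊆Q xs)
  ... | yes Px | no ¬Qx = ⊥-elim (¬Qx (P⊆Q Px))
  ... | no _   | yes _  = m≤n⇒m≤1+n (length-filter-mono P⊆Q xs)
  ... | no _   | no _   = length-filter-mono P⊆Q xs

  length-filter-mono-< : (∀ {x} → P x → Q x) → ∀ {y xs} → y ∈ xs → Q y → ¬ P y →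
    length (filter P? xs) < length (filter Q? xs)
  length-filter-mono-< P⊆Q {xs = x ∷ xs} y∈ Qy ¬Py with P? x | Q? x | y∈
  ... | yes Px | _      | here refl = ⊥-elim (¬Py Px)
  ... | no _   | yes _  | here refl = s≤s (length-filter-mono P⊆Q xs)
  ... | no _   | no ¬Qx | here refl = ⊥-elim (¬Qx Qy)
  ... | yes _  | yes _  | there y∈xs = s≤s (length-filter-mono-< P⊆Q y∈xs Qy ¬Py)
  ... | yes Px | no ¬Qx | there _ = ⊥-elim (¬Qx (P⊆Q Px))
  ... | no _   | yes _  | there y∈xs = m≤n⇒m≤1+n (length-filter-mono-< P⊆Q y∈xs Qy ¬Py)
  ... | no _   | no _   | there y∈xs = length-filter-mono-< P⊆Q y∈xs Qy ¬Py

module _ {A : Set} where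

  sum-map-+ : (f g : A → ℕ) (xs : List A) →
    sum (map (λ x → f x + g x) xs) ≡ sum (map f xs) + sum (map g xs)
  sum-map-+ f g [] = refl
  sum-map-+ f g (x ∷ xs) = trans (cong (f x + g x +_) (sum-map-+ f g xs)) (interchange (f x) (g x) _ _)

  sum-map-*ʳ : (f : A → ℕ) (c : ℕ) (xs : List A) → sum (map (λ x → f x * c) xs) ≡ sum (map f xs) * c
  sum-map-*ʳ f c [] = refl
  sum-map-*ʳ f c (x ∷ xs) = trans (cong (f x * c +_) (sum-map-*ʳ f c xs)) (sym (*-distribʳ-+ c (f x) _))

  sum-map-0 : (xs : List A) → sum (map (λ _ → 0) xs) ≡ 0
  sum-map-0 [] = refl
  sum-map-0 (x ∷ xs) = sum-map-0 xs

module _ {A : Set} {P : Pred A 0ℓ} (P? : Decidable P) where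

  length-filter-∷ : ∀ x xs →
    length (filter P? (x ∷ xs)) ≡ length (filter P? (x ∷ [])) + length (filter P? xs)
  length-filter-∷ x xs with P? x
  ... | yes _ = refl
  ... | no _ = refl

  length-filter-∁ : ∀ xs → length (filter P? xs) + length (filter (∁? P?) xs) ≡ length xs
  length-filter-∁ [] = refl
  length-filter-∁ (x ∷ xs) with P? x
  ... | yes _ = cong suc (length-filter-∁ xs)
  ... | no _ = trans (+-suc _ _) (cong suc (length-filter-∁ xs))

  sum-map-indicator : ∀ c xs → sum (map (λ x → if does (P? x) then c else 0) xs) ≡ length (filter P? xs) * c
  sum-map-indicator c [] = refl
  sum-map-indicator c (x ∷ xs) with P? x
  ... | yes _ = cong (c +_) (sum-map-indicator c xs)
  ... | no _ = sum-map-indicator c xs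

  length-filter-inverse : {Q : Pred A 0ℓ} (Q? : Decidable Q) (f g : A → A) →
    (∀ x → g (f x) ≡ x) → (∀ y → f (g y) ≡ y) →
    {L : List A} → Unique L → (∀ {x} → x ∈ L → f x ∈ L) → (∀ {y} → y ∈ L → g y ∈ L) →
    (∀ {x} → P x → Q (f x)) → (∀ {y} → Q y → P (g y)) →
    length (filter P? L) ≡ length (filter Q? L)
  length-filter-inverse Q? f g g∘f≡id f∘g≡id {L} u f∈L g∈L P⇒Qf Q⇒Pg = begin
    length (filter P? L)         ≡⟨ length-map f (filter P? L) ⟨
    length (map f (filter P? L)) ≡⟨ unique∧set⇒length≡ (Unique-map⁺ f-injective (filter⁺ P? u)) (filter⁺ Q? u)
                                      into onto ⟩
    length (filter Q? L)         ∎
    where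
    open ≡-Reasoning
    f-injective : ∀ {x y} → f x ≡ f y → x ≡ y
    f-injective {x} {y} fx≡fy = trans (sym (g∘f≡id x)) (trans (cong g fx≡fy) (g∘f≡id y))
    into : ∀ {y} → y ∈ map f (filter P? L) → y ∈ filter Q? L
    into y∈ with x , x∈ , refl ← ∈-map⁻ f y∈ with x∈L , Px ← ∈-filter⁻ P? x∈ =
      ∈-filter⁺ Q? (f∈L x∈L) (P⇒Qf Px)
    onto : ∀ {y} → y ∈ filter Q? L → y ∈ map f (filter P? L)
    onto {y} y∈ with y∈L , Qy ← ∈-filter⁻ Q? y∈ =
      subst (_∈ map f (filter P? L)) (f∘g≡id y) (∈-map⁺ f (∈-filter⁺ P? (g∈L y∈L) (Q⇒Pg Qy)))

module _ {n : ℕ} where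
  open DecMembership (_≟_ {n}) using (_∈?_)

  length-filter-∈? : {zs : List (Fin n)} → Unique zs → length (filter (_∈? zs) (allFin n)) ≡ length zs
  length-filter-∈? u = unique∧set⇒length≡ (filter⁺ (_∈? _) (allFin⁺ n)) u
    (λ z∈ → proj₂ (∈-filter⁻ (_∈? _) {xs = allFin n} z∈)) (λ z∈ → ∈-filter⁺ (_∈? _) (∈-allFin _) z∈)

  length-filter-≟ : (i : Fin n) → length (filter (i ≟_) (allFin n)) ≡ 1
  length-filter-≟ i = trans
    (cong length (filter-≐ (i ≟_) (_∈? (i ∷ [])) ((λ { refl → here refl }) , λ { (here refl) → refl }) (allFin n)))
    (length-filter-∈? (All.[] ∷ []))

module _ {A B : Set} {R : B → Pred A 0ℓ} (R? : ∀ j → Decidable (R j)) where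

  sum-length-filter-singleton : ∀ x (ys : List B) →
    sum (map (λ j → length (filter (R? j) (x ∷ []))) ys) ≡ length (filter (λ j → R? j x) ys)
  sum-length-filter-singleton x [] = refl
  sum-length-filter-singleton x (y ∷ ys) with R? y x
  ... | yes _ = cong suc (sum-length-filter-singleton x ys)
  ... | no _ = sum-length-filter-singleton x ys

module _ {A : Set} {n : ℕ} {P : Pred A 0ℓ} (P? : Decidable P) (g : A → Fin n) where

  fibre? : (j : Fin n) → Decidable (λ x → P x × g x ≡ j)
  fibre? j x = P? x ×-dec (g x ≟ j)

  private
    one-fibre : ∀ x → length (filter P? (x ∷ [])) ≡ length (filter (λ j → fibre? j x) (allFin n))
    one-fibre x with P? x
    ... | yes Px = sym (trans (cong length (filter-≐ _ (g x ≟_) (proj₂ , (Px ,_)) (allFin n)))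
                              (length-filter-≟ (g x)))
    ... | no ¬Px = sym (cong length
                    (filter-none (λ j → no ¬Px ×-dec (g x ≟ j)) {allFin n} (All.tabulate λ _ → ¬Px ∘ proj₁)))

  length-filter-fibres : ∀ xs →
    length (filter P? xs) ≡ sum (map (λ j → length (filter (fibre? j) xs)) (allFin n))
  length-filter-fibres [] = sym (sum-map-0 (allFin n))
  length-filter-fibres (x ∷ xs) = begin
    length (filter P? (x ∷ xs))
      ≡⟨ length-filter-∷ P? x xs ⟩
    length (filter P? (x ∷ [])) + length (filter P? xs)
      ≡⟨ cong₂ _+_ (trans (one-fibre x) (sym (sum-length-filter-singleton fibre? x (allFin n))))
                   (length-filter-fibres xs) ⟩
    sum (map (λ j → length (filter (fibre? j) (x ∷ []))) (allFin n))
      + sum (map (λ j → length (filter (fibre? j) xs)) (allFin n))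
      ≡⟨ sum-map-+ _ _ (allFin n) ⟨
    sum (map (λ j → length (filter (fibre? j) (x ∷ [])) + length (filter (fibre? j) xs)) (allFin n))
      ≡⟨ cong sum (map-cong (λ j → length-filter-∷ (fibre? j) x xs) (allFin n)) ⟨
    sum (map (λ j → length (filter (fibre? j) (x ∷ xs))) (allFin n)) ∎
    where open ≡-Reasoning

module _ {A : Set} {f g : A → ℕ} where

  sum-map-mono-≤ : {xs : List A} → (∀ {x} → x ∈ xs → f x ≤ g x) → sum (map f xs) ≤ sum (map g xs)
  sum-map-mono-≤ {[]} f≤g = z≤n
  sum-map-mono-≤ {x ∷ xs} f≤g = +-mono-≤ (f≤g (here refl)) (sum-map-mono-≤ (f≤g ∘ there))

  sum-map-mono-< : {xs : List A} → (∀ {x} → x ∈ xs → f x ≤ g x) →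
    ∀ {y} → y ∈ xs → f y < g y → sum (map f xs) < sum (map g xs)
  sum-map-mono-< {x ∷ xs} f≤g (here refl) fx<gx = +-mono-<-≤ fx<gx (sum-map-mono-≤ (f≤g ∘ there))
  sum-map-mono-< {x ∷ xs} f≤g (there y∈) fy<gy =
    +-mono-≤-< (f≤g (here refl)) (sum-map-mono-< (f≤g ∘ there) y∈ fy<gy)

module _ {A : Set} {v w : A → ℕ} {X C : ℕ} where

  equal-sums⇒equal-values : {xs : List A} →
    (∀ {x} → x ∈ xs → v x ≡ w x ⊎ (v x ≡ X × w x ≡ C)) → ∀ {y} → y ∈ xs → v y ≡ X → w y ≡ C →
    sum (map v xs) ≡ sum (map w xs) → X ≡ C
  equal-sums⇒equal-values {xs} v≈w y∈ vy≡X wy≡C Σv≡Σw with <-cmp X C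
  ... | tri≈ _ X≡C _ = X≡C
  ... | tri< X<C _ _ =
    ⊥-elim (<-irrefl Σv≡Σw (sum-map-mono-< v≤w y∈ (subst₂ _<_ (sym vy≡X) (sym wy≡C) X<C)))
    where
    v≤w : ∀ {x} → x ∈ xs → v x ≤ w x
    v≤w x∈ with v≈w x∈
    ... | inj₁ vx≡wx = ≤-reflexive vx≡wx
    ... | inj₂ (vx≡X , wx≡C) = subst₂ _≤_ (sym vx≡X) (sym wx≡C) (<⇒≤ X<C)
  ... | tri> _ _ C<X =
    ⊥-elim (<-irrefl (sym Σv≡Σw) (sum-map-mono-< w≤v y∈ (subst₂ _<_ (sym wy≡C) (sym vy≡X) C<X)))
    where
    w≤v : ∀ {x} → x ∈ xs → w x ≤ v x
    w≤v x∈ with v≈w x∈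
    ... | inj₁ vx≡wx = ≤-reflexive (sym vx≡wx)
    ... | inj₂ (vx≡X , wx≡C) = subst₂ _≤_ (sym wx≡C) (sym vx≡X) (<⇒≤ C<X)

module _ {A B C : Set} (h : A → B) {c′ : A → C} {c : B → C} where

  map-↭-by-bijection : {xs : List A} {ys : List B} → Unique xs → Unique ys →
    (∀ {x} → x ∈ xs → h x ∈ ys) → (∀ {x y} → x ∈ xs → y ∈ xs → h x ≡ h y → x ≡ y) →
    (∀ {y} → y ∈ ys → y ∈ map h xs) → (∀ {x} → x ∈ xs → c′ x ≡ c (h x)) →
    map c′ xs ↭ map c ys
  map-↭-by-bijection {xs} {ys} u v into inj onto c′≡c∘h =
    subst (_↭ map c ys) (sym (trans (map-cong-local (All.tabulate c′≡c∘h)) (map-∘ xs)))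
      (map⁺ c (unique∧set⇒↭ (map-unique-on u inj) v into′ onto))
    where
    into′ : ∀ {y} → y ∈ map h xs → y ∈ ys
    into′ y∈ with x , x∈ , refl ← ∈-map⁻ h y∈ = into x∈

-- Iterates, cycle lengths and orbits

module _ {n : ℕ} (ω : Map n) where

  iter-+ : ∀ j k i → iter ω (j + k) i ≡ iter ω j (iter ω k i)
  iter-+ zero k i = refl
  iter-+ (suc j) k i = cong (lookup ω) (iter-+ j k i)

  iter-lookup : ∀ k i → iter ω k (lookup ω i) ≡ lookup ω (iter ω k i)
  iter-lookup k i = trans (sym (iter-+ k 1 i)) (cong (λ t → iter ω t i) (+-comm k 1))

  iter-*-period : ∀ {p i} → iter ω p i ≡ i → ∀ t → iter ω (t * p) i ≡ i
  iter-*-period ωᵖi≡i zero = refl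
  iter-*-period {p} {i} ωᵖi≡i (suc t) =
    trans (iter-+ p (t * p) i) (trans (cong (iter ω p) (iter-*-period ωᵖi≡i t)) ωᵖi≡i)

  iter-% : ∀ {p i} .{{_ : NonZero p}} → iter ω p i ≡ i → ∀ k → iter ω k i ≡ iter ω (k % p) i
  iter-% {p} {i} ωᵖi≡i k = begin
    iter ω k i                             ≡⟨ cong (λ t → iter ω t i) (m≡m%n+[m/n]*n k p) ⟩
    iter ω (k % p + k / p * p) i           ≡⟨ iter-+ (k % p) (k / p * p) i ⟩
    iter ω (k % p) (iter ω (k / p * p) i)  ≡⟨ cong (iter ω (k % p)) (iter-*-period ωᵖi≡i (k / p)) ⟩
    iter ω (k % p) i                       ∎
    where open ≡-Reasoning

  cycLenFrom-minimal : ∀ i f k p → k ≤ p → p < cycLenFrom ω i k f → iter ω p i ≢ i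
  cycLenFrom-minimal i zero k p k≤p p<k = ⊥-elim (<⇒≱ p<k k≤p)
  cycLenFrom-minimal i (suc f) k p k≤p p< with iter ω k i Fin.≟ i
  ... | yes _ = ⊥-elim (<⇒≱ p< k≤p)
  ... | no ωᵏi≢i with m≤n⇒m<n∨m≡n k≤p
  ...   | inj₂ refl = ωᵏi≢i
  ...   | inj₁ k<p = cycLenFrom-minimal i f (suc k) p k<p p<

  cycLen-minimal : ∀ i p → 1 ≤ p → p < cycLen ω i → iter ω p i ≢ i
  cycLen-minimal i = cycLenFrom-minimal i n 1

cycLenFrom-cong : ∀ {n} (ω ω′ : Map n) {i i′} → (∀ p → iter ω p i ≡ i ⇔ iter ω′ p i′ ≡ i′) →
  ∀ k f → cycLenFrom ω i k f ≡ cycLenFrom ω′ i′ k f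
cycLenFrom-cong ω ω′ {i} {i′} same k zero = refl
cycLenFrom-cong ω ω′ {i} {i′} same k (suc f) with iter ω k i Fin.≟ i | iter ω′ k i′ Fin.≟ i′
... | yes _ | yes _ = refl
... | yes ret | no ¬ret′ = ⊥-elim (¬ret′ (Equivalence.to (same k) ret))
... | no ¬ret | yes ret′ = ⊥-elim (¬ret (Equivalence.from (same k) ret′))
... | no _ | no _ = cycLenFrom-cong ω ω′ same (suc k) f

cycLen-cong : ∀ {n} (ω ω′ : Map n) {i i′} → (∀ p → iter ω p i ≡ i ⇔ iter ω′ p i′ ≡ i′) →
  cycLen ω i ≡ cycLen ω′ i′
cycLen-cong {n} ω ω′ same = cycLenFrom-cong ω ω′ same 1 n

module Orbits {n : ℕ} (ω : Map n) (perm : IsPerm ω) where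

  open import Data.List.Extrema (Fin.≤-totalOrder n) using (min; min≤v⁺; argmin-sel)

  iter-injective : ∀ k {i j} → iter ω k i ≡ iter ω k j → i ≡ j
  iter-injective zero eq = eq
  iter-injective (suc k) eq = iter-injective k (perm _ _ eq)

  iter-comm : ∀ j k i → iter ω j (iter ω k i) ≡ iter ω k (iter ω j i)
  iter-comm j k i = trans (sym (iter-+ ω j k i)) (trans (cong (λ t → iter ω t i) (+-comm j k)) (iter-+ ω k j i))

  period : ∀ i → ∃ λ p → 0 < p × p ≤ n × iter ω p i ≡ i
  period i with t , u , t<u , ωᵗi≡ωᵘi ← Fin.pigeonhole (n<1+n n) (λ t → iter ω (toℕ t) i) =
    toℕ u ∸ toℕ t , m<n⇒0<n∸m t<u , ≤-trans (m∸n≤m (toℕ u) (toℕ t)) (Fin.toℕ≤pred[n] u) ,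
    iter-injective (toℕ t) returns
    where
    returns : iter ω (toℕ t) (iter ω (toℕ u ∸ toℕ t) i) ≡ iter ω (toℕ t) i
    returns = trans (sym (iter-+ ω (toℕ t) _ i))
      (trans (cong (λ s → iter ω s i) (m+[n∸m]≡n (<⇒≤ t<u))) (sym ωᵗi≡ωᵘi))

  orbit : Fin n → List (Fin n)
  orbit i = map (λ k → iter ω k i) (upTo n)

  iter∈orbit : ∀ k i → iter ω k i ∈ orbit i
  iter∈orbit k i with p , 0<p , p≤n , ωᵖi≡i ← period i =
    subst (_∈ orbit i) (sym (iter-% ω {{>-nonZero 0<p}} ωᵖi≡i k))
      (∈-map⁺ (λ k → iter ω k i) (∈-upTo⁺ (<-≤-trans (m%n<n k p {{>-nonZero 0<p}}) p≤n)))

  _∼_ : Fin n → Fin n → Set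
  i ∼ j = ∃ λ k → iter ω k i ≡ j

  ∼-trans : ∀ {i j l} → i ∼ j → j ∼ l → i ∼ l
  ∼-trans {i} (k , refl) (k′ , refl) = k′ + k , iter-+ ω k′ k i

  ∼-sym : ∀ {i j} → i ∼ j → j ∼ i
  ∼-sym {i} (k , refl) with p , 0<p , _ , ωᵖi≡i ← period i =
    k * p ∸ k , trans (sym (iter-+ ω (k * p ∸ k) k i))
      (trans (cong (λ t → iter ω t i) (m∸n+n≡m (m≤m*n k p {{>-nonZero 0<p}}))) (iter-*-period ω ωᵖi≡i k))

  leader : Fin n → Fin n
  leader i = min i (orbit i)

  IsLeader : Fin n → Set
  IsLeader x = All (λ k → x Fin.≤ iter ω k x) (upTo n)

  ∼-leader : ∀ i → i ∼ leader i
  ∼-leader i with argmin-sel (λ x → x) i (orbit i)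
  ... | inj₁ leader≡i = 0 , sym leader≡i
  ... | inj₂ leader∈orbit with k , _ , eq ← ∈-map⁻ (λ k → iter ω k i) leader∈orbit = k , sym eq

  leader-≤ : ∀ {i j} → i ∼ j → leader i Fin.≤ j
  leader-≤ {i} (k , refl) = min≤v⁺ i (orbit i) (inj₂ (lose (iter∈orbit k i) Fin.≤-refl))

  leader-isLeader : ∀ i → IsLeader (leader i)
  leader-isLeader i = All.tabulate λ {k} _ → leader-≤ (∼-trans (∼-leader i) (k , refl))

  isLeader-≤ : ∀ {x y} → IsLeader x → x ∼ y → x Fin.≤ y
  isLeader-≤ {x} isLeader (k , refl) with k′ , k′<n , eq ← ∈-map⁻ (λ k → iter ω k x) (iter∈orbit k x) =
    subst (x Fin.≤_) (sym eq) (All.lookup isLeader k′<n)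

  leaders-∼⇒≡ : ∀ {x y} → IsLeader x → IsLeader y → x ∼ y → x ≡ y
  leaders-∼⇒≡ isLeader-x isLeader-y x∼y =
    Fin.≤-antisym (isLeader-≤ isLeader-x x∼y) (isLeader-≤ isLeader-y (∼-sym x∼y))

  cycLen-∼ : ∀ {i j} → i ∼ j → cycLen ω i ≡ cycLen ω j
  cycLen-∼ {i} (k , refl) = cycLen-cong ω ω λ p → mk⇔
    (λ ωᵖi≡i → trans (iter-comm p k i) (cong (iter ω k) ωᵖi≡i))
    (λ returns → iter-injective k (trans (iter-comm k p i) returns))

  cycLen∈cycleType : ∀ i → cycLen ω i ∈ cycleType ω
  cycLen∈cycleType i = subst (_∈ cycleType ω) (sym (cycLen-∼ (∼-leader i)))
    (∈-map⁺ (cycLen ω) (∈-filter⁺ (leader? ω) (∈-allFin _) (leader-isLeader i)))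

-- Conjugation by a permutation of [n]

⟨$⟩ʳ-injective : ∀ {n} (π : Permutation′ n) {i j} → π ⟨$⟩ʳ i ≡ π ⟨$⟩ʳ j → i ≡ j
⟨$⟩ʳ-injective π eq = trans (sym (inverseˡ π)) (trans (cong (π ⟨$⟩ˡ_) eq) (inverseˡ π))

conj : ∀ {n} → Permutation′ n → Map n → Map n
conj π ω = tabulate λ i → π ⟨$⟩ʳ lookup ω (π ⟨$⟩ˡ i)

lookup-conj : ∀ {n} (π : Permutation′ n) ω i → lookup (conj π ω) i ≡ π ⟨$⟩ʳ lookup ω (π ⟨$⟩ˡ i)
lookup-conj π ω = lookup∘tabulate _

module _ {n : ℕ} (π : Permutation′ n) where

  conj-flip : ∀ ω → conj π (conj (flip π) ω) ≡ ω
  conj-flip ω = trans (tabulate-cong λ i → begin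
      π ⟨$⟩ʳ lookup (conj (flip π) ω) (π ⟨$⟩ˡ i)    ≡⟨ cong (π ⟨$⟩ʳ_) (lookup-conj (flip π) ω _) ⟩
      π ⟨$⟩ʳ (π ⟨$⟩ˡ lookup ω (π ⟨$⟩ʳ (π ⟨$⟩ˡ i)))  ≡⟨ inverseʳ π ⟩
      lookup ω (π ⟨$⟩ʳ (π ⟨$⟩ˡ i))                  ≡⟨ cong (lookup ω) (inverseʳ π) ⟩
      lookup ω i                                     ∎)
    (tabulate∘lookup ω)
    where open ≡-Reasoning

  iter-conj : ∀ ω k i → iter (conj π ω) k i ≡ π ⟨$⟩ʳ iter ω k (π ⟨$⟩ˡ i)
  iter-conj ω zero i = sym (inverseʳ π)
  iter-conj ω (suc k) i = trans (cong (lookup (conj π ω)) (iter-conj ω k i))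
    (trans (lookup-conj π ω _) (cong (λ j → π ⟨$⟩ʳ lookup ω j) (inverseˡ π)))

  conj-isPerm : ∀ {ω} → IsPerm ω → IsPerm (conj π ω)
  conj-isPerm {ω} perm i j eq = ⟨$⟩ʳ-injective (flip π) (perm _ _ (⟨$⟩ʳ-injective π
    (trans (sym (lookup-conj π ω i)) (trans eq (lookup-conj π ω j)))))

  cycLen-conj : ∀ ω i → cycLen (conj π ω) i ≡ cycLen ω (π ⟨$⟩ˡ i)
  cycLen-conj ω i = cycLen-cong (conj π ω) ω λ p → mk⇔
    (λ returns → ⟨$⟩ʳ-injective π (trans (sym (iter-conj ω p i)) (trans returns (sym (inverseʳ π)))))
    (λ returns → trans (iter-conj ω p i) (trans (cong (π ⟨$⟩ʳ_) returns) (inverseʳ π)))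

  cycleType-conj : ∀ {ω} → IsPerm ω → cycleType (conj π ω) ↭ cycleType ω
  cycleType-conj {ω} perm = map-↭-by-bijection h
    (filter⁺ (leader? ω′) (allFin⁺ n)) (filter⁺ (leader? ω) (allFin⁺ n)) into injective onto cycLen-h
    where
    ω′ = conj π ω
    module O = Orbits ω perm
    module O′ = Orbits ω′ (conj-isPerm {ω} perm)
    h : Fin n → Fin n
    h a = O.leader (π ⟨$⟩ˡ a)
    isLeader′ : ∀ {a} → a ∈ filter (leader? ω′) (allFin n) → O′.IsLeader a
    isLeader′ a∈ = proj₂ (∈-filter⁻ (leader? ω′) {xs = allFin n} a∈)
    into : ∀ {a} → a ∈ filter (leader? ω′) (allFin n) → h a ∈ filter (leader? ω) (allFin n)
    into {a} _ = ∈-filter⁺ (leader? ω) (∈-allFin _) (O.leader-isLeader (π ⟨$⟩ˡ a))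
    injective : ∀ {a a′} → a ∈ filter (leader? ω′) (allFin n) → a′ ∈ filter (leader? ω′) (allFin n) →
      h a ≡ h a′ → a ≡ a′
    injective {a} {a′} a∈ a′∈ ha≡ha′
      with k , ωᵏ≡ ← O.∼-trans (O.∼-leader _) (subst (O._∼ (π ⟨$⟩ˡ a′)) (sym ha≡ha′) (O.∼-sym (O.∼-leader _))) =
      O′.leaders-∼⇒≡ (isLeader′ a∈) (isLeader′ a′∈)
        (k , trans (iter-conj ω k a) (trans (cong (π ⟨$⟩ʳ_) ωᵏ≡) (inverseʳ π)))
    onto : ∀ {b} → b ∈ filter (leader? ω) (allFin n) → b ∈ map h (filter (leader? ω′) (allFin n))
    onto {b} b∈ with k , ω′ᵏ≡ ← O′.∼-leader (π ⟨$⟩ʳ b) =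
      subst (_∈ map h _) h[a]≡b (∈-map⁺ h (∈-filter⁺ (leader? ω′) (∈-allFin _) (O′.leader-isLeader (π ⟨$⟩ʳ b))))
      where
      a = O′.leader (π ⟨$⟩ʳ b)
      b∼π⁻¹a : b O.∼ (π ⟨$⟩ˡ a)
      b∼π⁻¹a = k , ⟨$⟩ʳ-injective π (trans (sym (cong (λ j → π ⟨$⟩ʳ iter ω k j) (inverseˡ π)))
        (trans (sym (iter-conj ω k (π ⟨$⟩ʳ b))) (trans ω′ᵏ≡ (sym (inverseʳ π)))))
      h[a]≡b : h a ≡ b
      h[a]≡b = O.leaders-∼⇒≡ (O.leader-isLeader _) (proj₂ (∈-filter⁻ (leader? ω) {xs = allFin n} b∈))
        (O.∼-trans (O.∼-sym (O.∼-leader _)) (O.∼-sym b∼π⁻¹a))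
    cycLen-h : ∀ {a} → a ∈ filter (leader? ω′) (allFin n) → cycLen ω′ a ≡ cycLen ω (h a)
    cycLen-h {a} _ = trans (cycLen-conj ω a) (O.cycLen-∼ (O.∼-leader _))

  conj-inClass : ∀ {λ′ ω} → InClass λ′ ω → InClass λ′ (conj π ω)
  conj-inClass {ω = ω} (perm , type) = conj-isPerm {ω} perm , ↭-trans (cycleType-conj perm) type

  conj-satisfies : ∀ {ω J} → Satisfies ω J →
    Satisfies (conj π ω) (map (Product.map (π ⟨$⟩ʳ_) (π ⟨$⟩ʳ_)) J)
  conj-satisfies {ω} sat = All.map⁺ (All.map (λ {e} ωi≡j → trans (lookup-conj π ω _)
    (trans (cong (λ i → π ⟨$⟩ʳ lookup ω i) (inverseˡ π)) (cong (π ⟨$⟩ʳ_) ωi≡j))) sat)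

module _ {n : ℕ} (i j : Fin n) where

  transpose-left : transpose i j ⟨$⟩ʳ i ≡ j
  transpose-left with i Fin.≟ i
  ... | yes _ = refl
  ... | no i≢i = ⊥-elim (i≢i refl)

  transpose-fixes : ∀ {k} → k ≢ i → k ≢ j → transpose i j ⟨$⟩ʳ k ≡ k
  transpose-fixes {k} k≢i k≢j with k Fin.≟ i
  ... | yes k≡i = ⊥-elim (k≢i k≡i)
  ... | no _ with k Fin.≟ j
  ...   | yes k≡j = ⊥-elim (k≢j k≡j)
  ...   | no _ = refl

-- Walks in G(K)

module _ {n : ℕ} where

  sources targets : Constraint n → List (Fin n)
  sources J = map proj₁ J
  targets J = map proj₂ J

  walk-⊆ : ∀ {J J′ : Constraint n} → (∀ {e} → e ∈ J → e ∈ J′) → ∀ {a b k} → Walk J a b k → Walk J′ a b k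
  walk-⊆ J⊆J′ nil = nil
  walk-⊆ J⊆J′ (cons e∈ w) = cons (J⊆J′ e∈) (walk-⊆ J⊆J′ w)

  hasCycle-⊆ : ∀ {J J′ : Constraint n} → (∀ {e} → e ∈ J → e ∈ J′) → HasCycle J → HasCycle J′
  hasCycle-⊆ J⊆J′ (v , k , w) = v , k , walk-⊆ J⊆J′ w

  walk-snoc : ∀ {J : Constraint n} {a b c k} → Walk J a b k → (b , c) ∈ J → Walk J a c (suc k)
  walk-snoc nil e∈ = cons e∈ nil
  walk-snoc (cons e∈′ w) e∈ = cons e∈′ (walk-snoc w e∈)

  walk-unsnoc : ∀ {J : Constraint n} {a c k} → Walk J a c (suc k) → ∃ λ b → Walk J a b k × (b , c) ∈ J
  walk-unsnoc (cons e∈ nil) = _ , nil , e∈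
  walk-unsnoc (cons e∈ (cons e∈′ w)) with b , w′ , last∈ ← walk-unsnoc (cons e∈′ w) = b , cons e∈ w′ , last∈

  walk-++ : ∀ {J : Constraint n} {a b c k l} → Walk J a b k → Walk J b c l → Walk J a c (k + l)
  walk-++ nil w = w
  walk-++ (cons e∈ w) w′ = cons e∈ (walk-++ w w′)

  walk-∷ : ∀ {J : Constraint n} {a x u v k} → Walk ((a , x) ∷ J) u v k →
    Walk J u v k ⊎ ((∃ λ l → Walk J u a l) × (∃ λ l → Walk J x v l))
  walk-∷ nil = inj₁ nil
  walk-∷ (cons (here refl) w) with walk-∷ w
  ... | inj₁ w′ = inj₂ ((_ , nil) , (_ , w′))
  ... | inj₂ (_ , x⇝v) = inj₂ ((_ , nil) , x⇝v)
  walk-∷ (cons (there e∈) w) with walk-∷ w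
  ... | inj₁ w′ = inj₁ (cons e∈ w′)
  ... | inj₂ ((_ , u⇝a) , x⇝v) = inj₂ ((_ , cons e∈ u⇝a) , x⇝v)

  walk-iter : ∀ {ω : Map n} {J} → Satisfies ω J → ∀ {a b k} → Walk J a b k → iter ω k a ≡ b
  walk-iter sat nil = refl
  walk-iter {ω} sat {k = suc k} (cons e∈ w) =
    trans (sym (iter-lookup ω k _)) (trans (cong (iter ω k) (All.lookup sat e∈)) (walk-iter sat w))

  walk-sources : ∀ {ω : Map n} {J} → Satisfies ω J → ∀ {a b k} → Walk J a b k →
    ∀ t → t < k → iter ω t a ∈ sources J
  walk-sources sat (cons e∈ w) zero _ = ∈-map⁺ proj₁ e∈
  walk-sources {ω} sat (cons e∈ w) (suc t) (s≤s t<k) =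
    subst (_∈ _) (trans (cong (iter ω t) (sym (All.lookup sat e∈))) (iter-lookup ω t _))
      (walk-sources sat w t t<k)

  open DecMembership (Fin._≟_ {n}) using (_∈?_)

  private
    ↭-⊆ : ∀ {J J′ : Constraint n} {e} → J ↭ e ∷ J′ → ∀ {e′} → e′ ∈ J′ → e′ ∈ J
    ↭-⊆ J↭ e′∈ = ∈-resp-↭ (↭-sym J↭) (there e′∈)

    root-acc : ∀ (J : Constraint n) → Acc _<_ (length J) → ¬ HasCycle J → ∀ a →
      ∃ λ s → s ∉ targets J × ∃ λ ℓ → Walk J s a ℓ
    root-acc J (acc rs) acyclic a with a ∈? targets J
    ... | no a∉ = a , a∉ , 0 , nil
    ... | yes a∈ with (p , _) , e∈ , refl ← ∈-map⁻ proj₂ a∈ with J′ , J↭ ← ∈⇒↭∷ e∈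
      with s , s∉ , ℓ , s⇝p ← root-acc J′ (rs (≤-reflexive (sym (↭-length J↭)))) (acyclic ∘ hasCycle-⊆ (↭-⊆ J↭)) p
      =
      s , s∉targets , suc ℓ , s⇝a
      where
      s⇝a : Walk J s a (suc ℓ)
      s⇝a = walk-snoc (walk-⊆ (↭-⊆ J↭) s⇝p) e∈
      s∉targets : s ∉ targets J
      s∉targets s∈ with ∈-resp-↭ (map⁺ proj₂ J↭) s∈
      ... | here refl = acyclic (s , ℓ , s⇝a)
      ... | there s∈′ = s∉ s∈′

    terminal-acc : ∀ (J : Constraint n) → Acc _<_ (length J) → ¬ HasCycle J → ∀ a →
      ∃ λ t → t ∉ sources J × ∃ λ ℓ → Walk J a t ℓ
    terminal-acc J (acc rs) acyclic a with a ∈? sources J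
    ... | no a∉ = a , a∉ , 0 , nil
    ... | yes a∈ with (_ , c) , e∈ , refl ← ∈-map⁻ proj₁ a∈ with J′ , J↭ ← ∈⇒↭∷ e∈
      with t , t∉ , ℓ , c⇝t ← terminal-acc J′ (rs (≤-reflexive (sym (↭-length J↭)))) (acyclic ∘ hasCycle-⊆ (↭-⊆ J↭)) c
      =
      t , t∉sources , suc ℓ , a⇝t
      where
      a⇝t : Walk J a t (suc ℓ)
      a⇝t = cons e∈ (walk-⊆ (↭-⊆ J↭) c⇝t)
      t∉sources : t ∉ sources J
      t∉sources t∈ with ∈-resp-↭ (map⁺ proj₁ J↭) t∈
      ... | here refl = acyclic (t , ℓ , a⇝t)
      ... | there t∈′ = t∉ t∈′

  root : ∀ (J : Constraint n) → ¬ HasCycle J → ∀ a → ∃ λ s → s ∉ targets J × ∃ λ ℓ → Walk J s a ℓ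
  root J = root-acc J (<-wellFounded _)

  terminal : ∀ (J : Constraint n) → ¬ HasCycle J → ∀ a → ∃ λ t → t ∉ sources J × ∃ λ ℓ → Walk J a t ℓ
  terminal J = terminal-acc J (<-wellFounded _)

  roots-unique : ∀ {J : Constraint n} → Unique (targets J) → ∀ {s s′ a} → s ∉ targets J → s′ ∉ targets J →
    ∀ k l → Walk J s a k → Walk J s′ a l → s ≡ s′
  roots-unique u s∉ s′∉ zero zero nil nil = refl
  roots-unique u s∉ s′∉ zero (suc l) nil w with _ , _ , e∈ ← walk-unsnoc w = ⊥-elim (s∉ (∈-map⁺ proj₂ e∈))
  roots-unique u s∉ s′∉ (suc k) zero w nil with _ , _ , e∈ ← walk-unsnoc w = ⊥-elim (s′∉ (∈-map⁺ proj₂ e∈))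
  roots-unique u s∉ s′∉ (suc k) (suc l) w w′
    with _ , w₀ , e∈ ← walk-unsnoc w | _ , w₀′ , e∈′ ← walk-unsnoc w′
    with refl ← unique-map⇒injective-on u e∈ e∈′ refl = roots-unique u s∉ s′∉ k l w₀ w₀′

module _ {n : ℕ} {ω : Map n} (perm : IsPerm ω) where
  open Orbits ω perm

  iterates-distinct : ∀ {i s t} → s < t → t ∸ s < cycLen ω i → iter ω s i ≢ iter ω t i
  iterates-distinct {i} {s} {t} s<t gap<cycLen ωˢi≡ωᵗi =
    cycLen-minimal ω i (t ∸ s) (m<n⇒0<n∸m s<t) gap<cycLen (iter-injective s (begin
      iter ω s (iter ω (t ∸ s) i)  ≡⟨ iter-+ ω s (t ∸ s) i ⟨
      iter ω (s + (t ∸ s)) i       ≡⟨ cong (λ u → iter ω u i) (m+[n∸m]≡n (<⇒≤ s<t)) ⟩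
      iter ω t i                   ≡⟨ ωˢi≡ωᵗi ⟨
      iter ω s i                   ∎))
    where open ≡-Reasoning

  satisfied-wellDefined : ∀ {K : Constraint n} → Unique K → Satisfies ω K → WellDefined K
  satisfied-wellDefined uK sat =
    map-unique-on uK (λ { {i , j} {i′ , j′} e∈ e′∈ refl →
      cong (i ,_) (trans (sym (All.lookup sat e∈)) (All.lookup sat e′∈)) }) ,
    map-unique-on uK (λ { {i , j} {i′ , j′} e∈ e′∈ refl →
      cong (_, j) (perm i i′ (trans (All.lookup sat e∈) (sym (All.lookup sat e′∈)))) })

  satisfied-acyclic : ∀ {m} {J : Constraint n} → (∀ i → suc m ≤ cycLen ω i) → Satisfies ω J → length J ≤ m →
    ¬ HasCycle J
  satisfied-acyclic {m} {J} long sat |J|≤m (v , ℓ , v⇝v) with suc ℓ ≤? m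
  ... | yes 1+ℓ≤m =
    cycLen-minimal ω v (suc ℓ) (s≤s z≤n) (≤-trans (s≤s 1+ℓ≤m) (long v)) (walk-iter {ω = ω} sat v⇝v)
  ... | no 1+ℓ≰m = no-repeated-source (Fin.pigeonhole |sources|<1+m source-index)
    where
    visited : (t : Fin (suc m)) → iter ω (toℕ t) v ∈ sources J
    visited t = walk-sources {ω = ω} sat v⇝v (toℕ t) (<-≤-trans (Fin.toℕ<n t) (≰⇒> 1+ℓ≰m))
    source-index : Fin (suc m) → Fin (length (sources J))
    source-index t = Any.index (visited t)
    |sources|<1+m : length (sources J) < suc m
    |sources|<1+m = s≤s (≤-trans (≤-reflexive (length-map proj₁ J)) |J|≤m)
    no-repeated-source : ∃₂ (λ i j → i Fin.< j × source-index i ≡ source-index j) → ⊥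
    no-repeated-source (i , j , i<j , same-index) =
      iterates-distinct i<j (<-≤-trans (s≤s (≤-trans (m∸n≤m (toℕ j) (toℕ i)) (Fin.toℕ≤pred[n] j))) (long v))
        (SetoidMembership.index-injective (setoid (Fin n)) (visited i) (visited j) same-index)

inClass-long-cycles : ∀ {n m λ′} {ω : Map n} → InClass λ′ ω → All (λ p → suc m ≤ p) λ′ →
  ∀ i → suc m ≤ cycLen ω i
inClass-long-cycles {ω = ω} (perm , type) long-parts i =
  All.lookup long-parts (∈-resp-↭ type (Orbits.cycLen∈cycleType ω perm i))

final-edge : ∀ {n} {J : Constraint n} {e} → ¬ HasCycle J → e ∈ J → ∃₂ λ a b → (a , b) ∈ J × b ∉ sources J
final-edge {J = J} {a₀ , b₀} acyclic e∈ with t , t∉ , ℓ , b₀⇝t ← terminal J acyclic b₀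
  with a , _ , last∈ ← walk-unsnoc (cons e∈ b₀⇝t) = a , t , last∈ , t∉

-- Counting the members of C_λ that satisfy a constraint

module _ {n : ℕ} {P : Map n → Set} {L : List (Map n)} (enum : Enumerates P L) where

  enumerations-length : {L′ : List (Map n)} → Enumerates P L′ → length L ≡ length L′
  enumerations-length enum′ = unique∧set⇒length≡ (proj₁ enum) (proj₁ enum′)
    (λ {ω} ω∈ → Equivalence.from (proj₂ enum′ ω) (Equivalence.to (proj₂ enum ω) ω∈))
    (λ {ω} ω∈ → Equivalence.from (proj₂ enum ω) (Equivalence.to (proj₂ enum′ ω) ω∈))

  enumerates-filter : {Q : Map n → Set} (Q? : Decidable Q) → Enumerates (λ ω → P ω × Q ω) (filter Q? L)
  enumerates-filter Q? = filter⁺ Q? (proj₁ enum) , λ ω → mk⇔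
    (λ ω∈ → Product.map₁ (Equivalence.to (proj₂ enum ω)) (∈-filter⁻ Q? ω∈))
    (λ (Pω , Qω) → ∈-filter⁺ Q? (Equivalence.from (proj₂ enum ω) Pω) Qω)

enumerates-empty : ∀ {n} {P : Map n → Set} {L : List (Map n)} → Enumerates P L → (∀ ω → ¬ P ω) → length L ≡ 0
enumerates-empty {L = []} _ _ = refl
enumerates-empty {L = ω ∷ _} (_ , ω∈⇔) ¬P = ⊥-elim (¬P ω (Equivalence.to (ω∈⇔ ω) (here refl)))

transpose-fixes-constraint : ∀ {n} {u w : Fin n} {J : Constraint n} →
  u ∉ sources J → u ∉ targets J → w ∉ sources J → w ∉ targets J →
  map (Product.map (transpose u w ⟨$⟩ʳ_) (transpose u w ⟨$⟩ʳ_)) J ≡ J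
transpose-fixes-constraint {u = u} {w} {J} u∉s u∉t w∉s w∉t = map-id-local (All.tabulate λ e∈ → cong₂ _,_
  (transpose-fixes u w (λ eq → u∉s (subst (_∈ sources J) eq (∈-map⁺ proj₁ e∈)))
                       (λ eq → w∉s (subst (_∈ sources J) eq (∈-map⁺ proj₁ e∈))))
  (transpose-fixes u w (λ eq → u∉t (subst (_∈ targets J) eq (∈-map⁺ proj₂ e∈)))
                       (λ eq → w∉t (subst (_∈ targets J) eq (∈-map⁺ proj₂ e∈)))))

module Counting {n m : ℕ} {λ′ : List ℕ} (long-parts : All (λ p → suc m ≤ p) λ′)
  {Cλ : List (Map n)} (enumC : Enumerates (InClass λ′) Cλ) where

  open DecMembership (_≟_ {n}) using (_∈?_)

  satisfies? : (J : Constraint n) → Decidable (λ ω → Satisfies ω J)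
  satisfies? J ω = All.all? (λ e → lookup ω (proj₁ e) ≟ proj₂ e) J

  #satisfying : Constraint n → ℕ
  #satisfying J = length (filter (satisfies? J) Cλ)

  inClass : ∀ {ω} → ω ∈ Cλ → InClass λ′ ω
  inClass {ω} = Equivalence.to (proj₂ enumC ω)

  ∈Cλ : ∀ {ω} → InClass λ′ ω → ω ∈ Cλ
  ∈Cλ {ω} = Equivalence.from (proj₂ enumC ω)

  long-cycles : ∀ {ω} → ω ∈ Cλ → ∀ i → suc m ≤ cycLen ω i
  long-cycles ω∈ = inClass-long-cycles (inClass ω∈) long-parts

  #satisfying-[] : #satisfying [] ≡ length Cλ
  #satisfying-[] = cong length (filter-all (satisfies? []) {Cλ} (All.tabulate λ _ → []))

  #satisfying-resp-↭ : ∀ {J J′} → J ↭ J′ → #satisfying J ≡ #satisfying J′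
  #satisfying-resp-↭ J↭J′ = cong length
    (filter-≐ (satisfies? _) (satisfies? _) (All-resp-↭ J↭J′ , All-resp-↭ (↭-sym J↭J′)) Cλ)

  #satisfying-unsatisfiable : ∀ {J} → (∀ {ω} → ω ∈ Cλ → ¬ Satisfies ω J) → #satisfying J ≡ 0
  #satisfying-unsatisfiable ¬sat = cong length (filter-none (satisfies? _) {Cλ} (All.tabulate ¬sat))

  #satisfying-split : ∀ a J → #satisfying J ≡ sum (map (λ x → #satisfying ((a , x) ∷ J)) (allFin n))
  #satisfying-split a J = trans (length-filter-fibres (satisfies? J) (λ ω → lookup ω a) Cλ)
    (cong sum (map-cong (λ x → cong length (filter-≐ _ (satisfies? ((a , x) ∷ J))
      ((λ (sat , ωa≡x) → ωa≡x ∷ sat) , λ { (ωa≡x ∷ sat) → sat , ωa≡x }) Cλ)) (allFin n)))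

  vertices : Constraint n → List (Fin n)
  vertices J = sources J ++ targets J

  #touched : Constraint n → ℕ
  #touched J = length (filter (_∈? vertices J) (allFin n))

  measure : Constraint n → ℕ
  measure J = length J + #touched J

  module Extension (J′ : Constraint n) (a b : Fin n)
    (wellDefined : WellDefined ((a , b) ∷ J′)) (acyclic : ¬ HasCycle ((a , b) ∷ J′))
    (b∉sources : b ∉ sources J′) (fits : suc (length J′) ≤ m) where

    k : ℕ
    k = length J′

    ext : Fin n → Constraint n
    ext x = (a , x) ∷ J′

    a∉sources : a ∉ sources J′
    a∉sources = Unique[x∷xs]⇒x∉xs (proj₁ wellDefined)

    b∉targets : b ∉ targets J′
    b∉targets = Unique[x∷xs]⇒x∉xs (proj₂ wellDefined)

    J′-wellDefined : WellDefined J′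
    J′-wellDefined with _ ∷ unique-sources ← proj₁ wellDefined | _ ∷ unique-targets ← proj₂ wellDefined =
      unique-sources , unique-targets

    J′-acyclic : ¬ HasCycle J′
    J′-acyclic = acyclic ∘ hasCycle-⊆ there

    a≢b : a ≢ b
    a≢b refl = acyclic (a , 0 , cons (here refl) nil)

    private
      root-of-a = root J′ J′-acyclic a

    s : Fin n
    s = proj₁ root-of-a

    s∉targets : s ∉ targets J′
    s∉targets = proj₁ (proj₂ root-of-a)

    s⇝a : ∃ λ ℓ → Walk J′ s a ℓ
    s⇝a = proj₂ (proj₂ root-of-a)

    roots-are-s : ∀ {x ℓ} → x ∉ targets J′ → Walk J′ x a ℓ → x ≡ s
    roots-are-s x∉ x⇝a = roots-unique (proj₂ J′-wellDefined) x∉ s∉targets _ _ x⇝a (proj₂ s⇝a)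

    b≢s : b ≢ s
    b≢s b≡s = no-walk (subst (λ x → Walk J′ x a (proj₁ s⇝a)) (sym b≡s) (proj₂ s⇝a))
      where
      no-walk : ∀ {ℓ} → Walk J′ b a ℓ → ⊥
      no-walk nil = a≢b refl
      no-walk (cons e∈ _) = b∉sources (∈-map⁺ proj₁ e∈)

    ext-wellDefined : ∀ {x} → x ∉ targets J′ → WellDefined (ext x)
    ext-wellDefined x∉ = proj₁ wellDefined , ∉⇒Unique∷ x∉ (proj₂ J′-wellDefined)

    ext-acyclic : ∀ {x} → x ∉ targets J′ → x ≢ s → ¬ HasCycle (ext x)
    ext-acyclic x∉ x≢s (u , l , u⇝u) with walk-∷ u⇝u
    ... | inj₁ w = J′-acyclic (u , l , w)
    ... | inj₂ ((_ , u⇝a) , (_ , x⇝u)) = x≢s (roots-are-s x∉ (walk-++ x⇝u u⇝a))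

    J′-touches-no-more : #touched J′ ≤ #touched (ext b)
    J′-touches-no-more = length-filter-mono (_∈? vertices J′) (_∈? vertices (ext b)) vertex-of-ext-b (allFin n)
      where
      vertex-of-ext-b : ∀ {v} → v ∈ vertices J′ → v ∈ vertices (ext b)
      vertex-of-ext-b v∈ with ∈-++⁻ (sources J′) v∈
      ... | inj₁ v∈s = there (∈-++⁺ˡ v∈s)
      ... | inj₂ v∈t = ∈-++⁺ʳ (a ∷ sources J′) (there v∈t)

    ext-touches-less : ∀ {x} → x ∈ sources J′ → #touched (ext x) < #touched (ext b)
    ext-touches-less {x} x∈ =
      length-filter-mono-< (_∈? vertices (ext x)) (_∈? vertices (ext b)) vertex-of-ext-b (∈-allFin b) b∈ext-b b∉ext-x
      where
      vertex-of-ext-b : ∀ {v} → v ∈ vertices (ext x) → v ∈ vertices (ext b)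
      vertex-of-ext-b v∈ with ∈-++⁻ (a ∷ sources J′) v∈
      ... | inj₁ v∈s = ∈-++⁺ˡ v∈s
      ... | inj₂ (here refl) = ∈-++⁺ˡ (there x∈)
      ... | inj₂ (there v∈t) = ∈-++⁺ʳ (a ∷ sources J′) (there v∈t)
      b∈ext-b : b ∈ vertices (ext b)
      b∈ext-b = ∈-++⁺ʳ (a ∷ sources J′) (here refl)
      b∉ext-x : b ∉ vertices (ext x)
      b∉ext-x b∈ with ∈-++⁻ (a ∷ sources J′) b∈
      ... | inj₁ (here b≡a) = a≢b (sym b≡a)
      ... | inj₁ (there b∈s) = b∉sources b∈s
      ... | inj₂ (here refl) = b∉sources x∈
      ... | inj₂ (there b∈t) = b∉targets b∈t

    #satisfying-ext-target : ∀ {x} → x ∈ targets J′ → #satisfying (ext x) ≡ 0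
    #satisfying-ext-target x∈ with (i , _) , e∈ , refl ← ∈-map⁻ proj₂ x∈ =
      #satisfying-unsatisfiable λ { ω∈ (ωa≡x ∷ sat) → a∉sources (subst (_∈ sources J′) (proj₁ (inClass ω∈) i a (trans (All.lookup sat e∈) (sym ωa≡x)))
        (∈-map⁺ proj₁ e∈)) }

    #satisfying-ext-root : #satisfying (ext s) ≡ 0
    #satisfying-ext-root = #satisfying-unsatisfiable λ ω∈ sat →
      satisfied-acyclic (proj₁ (inClass ω∈)) (long-cycles ω∈) sat fits
        (s , _ , walk-snoc (walk-⊆ there (proj₂ s⇝a)) (here refl))

    #satisfying-ext-isolated : ∀ {x} → x ∉ sources J′ → x ∉ targets J′ → x ≢ a →
      #satisfying (ext x) ≡ #satisfying (ext b)
    #satisfying-ext-isolated {x} x∉s x∉t x≢a = length-filter-inverse (satisfies? (ext x)) (satisfies? (ext b))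
      (conj π) (conj (flip π)) (conj-flip (flip π)) (conj-flip π) (proj₁ enumC)
      (∈Cλ ∘ conj-inClass π ∘ inClass) (∈Cλ ∘ conj-inClass (flip π) ∘ inClass)
      (λ {ω} sat → subst (Satisfies (conj π ω)) ext-x↦ext-b (conj-satisfies π {ω} sat))
      (λ {ω} sat → subst (Satisfies (conj (flip π) ω)) ext-b↦ext-x (conj-satisfies (flip π) {ω} sat))
      where
      π = transpose x b
      a≢x : a ≢ x
      a≢x = x≢a ∘ sym
      ext-x↦ext-b : map (Product.map (π ⟨$⟩ʳ_) (π ⟨$⟩ʳ_)) (ext x) ≡ (ext b)
      ext-x↦ext-b = cong₂ _∷_ (cong₂ _,_ (transpose-fixes x b a≢x a≢b) (transpose-left x b))
        (transpose-fixes-constraint x∉s x∉t b∉sources b∉targets)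
      ext-b↦ext-x : map (Product.map (flip π ⟨$⟩ʳ_) (flip π ⟨$⟩ʳ_)) (ext b) ≡ ext x
      ext-b↦ext-x = cong₂ _∷_ (cong₂ _,_ (transpose-fixes b x a≢b a≢x) (transpose-left b x))
        (transpose-fixes-constraint b∉sources b∉targets x∉s x∉t)

    forbidden : List (Fin n)
    forbidden = s ∷ targets J′

    b∉forbidden : b ∉ forbidden
    b∉forbidden (here b≡s) = b≢s b≡s
    b∉forbidden (there b∈t) = b∉targets b∈t

    #allowed : length (filter (∁? (_∈? forbidden)) (allFin n)) ≡ n ∸ suc k
    #allowed = begin
      #∉                                ≡⟨ m+n∸m≡n (suc k) #∉ ⟨
      suc k + #∉ ∸ suc k                ≡⟨ cong (λ z → z + #∉ ∸ suc k) #forbidden ⟨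
      #∈ + #∉ ∸ suc k                   ≡⟨ cong (_∸ suc k) (length-filter-∁ (_∈? forbidden) (allFin n)) ⟩
      length (allFin n) ∸ suc k         ≡⟨ cong (_∸ suc k) (length-tabulate {n = n} (λ i → i)) ⟩
      n ∸ suc k                         ∎
      where
      open ≡-Reasoning
      #∈ #∉ : ℕ
      #∈ = length (filter (_∈? forbidden) (allFin n))
      #∉ = length (filter (∁? (_∈? forbidden)) (allFin n))
      #forbidden : #∈ ≡ suc k
      #forbidden = trans (length-filter-∈? (∉⇒Unique∷ s∉targets (proj₂ J′-wellDefined)))
        (cong suc (length-map proj₂ J′))

    extension-count : #satisfying J′ * fallingFrom n k ≡ length Cλ →
      (∀ {x} → x ∈ sources J′ → x ∉ targets J′ → x ≢ s →
         #satisfying (ext x) * fallingFrom n (suc k) ≡ length Cλ) →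
      #satisfying (ext b) * fallingFrom n (suc k) ≡ length Cλ
    extension-count count-J′ count-ext =
      equal-sums⇒equal-values dichotomy (∈-allFin b) refl (w-allowed b∉forbidden) Σv≡Σw
      where
      -- w is what v would be if every x outside `forbidden` gave |C_λ|; the two differ at most at the
      -- untouched x, where v is #satisfying (ext b) * F, and b is one of them.
      C F : ℕ
      C = length Cλ
      F = fallingFrom n (suc k)
      v w : Fin n → ℕ
      v x = #satisfying (ext x) * F
      w x = if does (∁? (_∈? forbidden) x) then C else 0

      w-forbidden : ∀ {x} → x ∈ forbidden → w x ≡ 0
      w-forbidden {x} x∈ = cong (λ d → if not d then C else 0) (dec-true (x ∈? forbidden) x∈)

      w-allowed : ∀ {x} → x ∉ forbidden → w x ≡ C
      w-allowed {x} x∉ = cong (λ d → if not d then C else 0) (dec-false (x ∈? forbidden) x∉)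

      dichotomy : ∀ {x} → x ∈ allFin n → v x ≡ w x ⊎ (v x ≡ #satisfying (ext b) * F × w x ≡ C)
      dichotomy {x} _ with x ∈? forbidden
      ... | yes x∈@(here refl) = inj₁ (trans (cong (_* F) #satisfying-ext-root) (sym (w-forbidden x∈)))
      ... | yes x∈@(there x∈t) = inj₁ (trans (cong (_* F) (#satisfying-ext-target x∈t)) (sym (w-forbidden x∈)))
      ... | no x∉ with x ∈? sources J′
      ...   | yes x∈s = inj₁ (trans (count-ext x∈s (x∉ ∘ there) (x∉ ∘ here)) (sym (w-allowed x∉)))
      ...   | no x∉s = inj₂ (cong (_* F) (#satisfying-ext-isolated x∉s (x∉ ∘ there) x≢a) , w-allowed x∉)
        where
        x≢a : x ≢ a
        x≢a refl = x∉ (here (roots-are-s (x∉ ∘ there) nil))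

      Σv≡Σw : sum (map v (allFin n)) ≡ sum (map w (allFin n))
      Σv≡Σw = begin
        sum (map v (allFin n))                               ≡⟨ sum-map-*ʳ (λ x → #satisfying (ext x)) F (allFin n) ⟩
        sum (map (λ x → #satisfying (ext x)) (allFin n)) * F ≡⟨ cong (_* F) (#satisfying-split a J′) ⟨
        #satisfying J′ * (fallingFrom n k * (n ∸ suc k))     ≡⟨ *-assoc (#satisfying J′) _ _ ⟨
        #satisfying J′ * fallingFrom n k * (n ∸ suc k)       ≡⟨ cong (_* (n ∸ suc k)) count-J′ ⟩
        C * (n ∸ suc k)                                      ≡⟨ *-comm C _ ⟩
        (n ∸ suc k) * C                                      ≡⟨ cong (_* C) #allowed ⟨
        length (filter (∁? (_∈? forbidden)) (allFin n)) * C  ≡⟨ sum-map-indicator (∁? (_∈? forbidden)) C (allFin n) ⟨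
        sum (map w (allFin n))                               ∎
        where open ≡-Reasoning

  measure-resp-↭ : ∀ {J J′} → J ↭ J′ → measure J ≡ measure J′
  measure-resp-↭ {J} {J′} J↭J′ = cong₂ _+_ (↭-length J↭J′) (cong length
    (filter-≐ (_∈? vertices J) (_∈? vertices J′) (∈-resp-↭ vertices↭ , ∈-resp-↭ (↭-sym vertices↭)) (allFin n)))
    where
    vertices↭ : vertices J ↭ vertices J′
    vertices↭ = ++⁺ (map⁺ proj₁ J↭J′) (map⁺ proj₂ J↭J′)

  count-acyclic : ∀ J → Acc _<_ (measure J) → WellDefined J → ¬ HasCycle J → length J ≤ m →
    #satisfying J * fallingFrom n (length J) ≡ length Cλ
  count-acyclic [] _ _ _ _ = trans (*-identityʳ _) #satisfying-[]
  count-acyclic J@(_ ∷ _) (acc smaller) wellDefined acyclic fits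
    with a , b , ab∈ , b∉ ← final-edge acyclic (here refl) with J′ , J↭ext-b ← ∈⇒↭∷ ab∈ =
    trans (cong₂ _*_ (#satisfying-resp-↭ J↭ext-b) (cong (fallingFrom n) (↭-length J↭ext-b)))
      (extension-count count-J′ count-ext)
    where
    ext-b⊆J : ∀ {e} → e ∈ (a , b) ∷ J′ → e ∈ J
    ext-b⊆J = ∈-resp-↭ (↭-sym J↭ext-b)
    fits′ : suc (length J′) ≤ m
    fits′ = subst (_≤ m) (↭-length J↭ext-b) fits
    open Extension J′ a b
      (Unique-resp-↭ (map⁺ proj₁ J↭ext-b) (proj₁ wellDefined) ,
       Unique-resp-↭ (map⁺ proj₂ J↭ext-b) (proj₂ wellDefined))
      (acyclic ∘ hasCycle-⊆ ext-b⊆J) (b∉ ∘ Subset.map⁺ proj₁ (ext-b⊆J ∘ there)) fits′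
    measure-J : measure J ≡ suc (length J′) + #touched (ext b)
    measure-J = measure-resp-↭ J↭ext-b
    count-J′ : #satisfying J′ * fallingFrom n (length J′) ≡ length Cλ
    count-J′ = count-acyclic J′
      (smaller (subst (measure J′ <_) (sym measure-J) (s≤s (+-monoʳ-≤ (length J′) J′-touches-no-more))))
      J′-wellDefined J′-acyclic (≤-trans (n≤1+n _) fits′)
    count-ext : ∀ {x} → x ∈ sources J′ → x ∉ targets J′ → x ≢ s →
      #satisfying (ext x) * fallingFrom n (suc (length J′)) ≡ length Cλ
    count-ext {x} x∈s x∉t x≢s = count-acyclic (ext x)
      (smaller (subst (measure (ext x) <_) (sym measure-J) (+-monoʳ-< (suc (length J′)) (ext-touches-less x∈s))))
      (ext-wellDefined x∉t) (ext-acyclic x∉t x≢s) fits′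

lemma7p15 : (n m : ℕ) (λ' : List ℕ) → IsPartition n λ' → All (λ p → suc m ≤ p) λ'
    → (K : Constraint n) → Unique K → length K ≡ m
    → (Cλ Sat : List (Map n))
    → Enumerates (InClass λ') Cλ
    → Enumerates (λ ω → InClass λ' ω × Satisfies ω K) Sat
    → (Acyclic K → length Sat * fallingFrom n m ≡ length Cλ)
      × (¬ Acyclic K → length Sat ≡ 0)
lemma7p15 n m λ′ _ long-parts K unique-K refl Cλ Sat enum-Cλ enum-Sat = acyclic-case , cyclic-case
  where
  open Counting long-parts enum-Cλ
  acyclic-case : Acyclic K → length Sat * fallingFrom n (length K) ≡ length Cλ
  acyclic-case (wellDefined , acyclic) = trans
    (cong (_* fallingFrom n (length K)) (enumerations-length enum-Sat (enumerates-filter enum-Cλ (satisfies? K))))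
    (count-acyclic K (<-wellFounded _) wellDefined acyclic ≤-refl)
  cyclic-case : ¬ Acyclic K → length Sat ≡ 0
  cyclic-case ¬acyclic = enumerates-empty enum-Sat λ ω (class , sat) → ¬acyclic
    (satisfied-wellDefined {ω = ω} (proj₁ class) unique-K sat ,
     satisfied-acyclic {ω = ω} (proj₁ class) (inClass-long-cycles class long-parts) sat ≤-refl)
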